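{- For every integer $n\geq0$, \[\dim_{\mathbb{Q}}B_n^{\mathrm{ev}}-\dim_{\mathbb{Q}}B_{n-1}^{\mathrm{ev}}=d_n=p_{n+3}\] (with the convention $B_{ -1}^{\mathrm{ev}}=0$).
   Context: For $s\geq1$ let $e_s=1$ if $s\geq3$ is odd and $e_s=0$ otherwise. Let $Q_n$ be the quiver with vertices $0,1,\dots,n$ and exactly $e_{i-j}$ edges from $j$ to $i$ for each $j<i$ (and no other edges), and let $Q_\infty$ be the analogous quiver on vertices $\mathbb{Z}_{\geq0}$. Let $B_n=\mathbb{Q}Q_n$ be the path algebra (paths concatenated, products of non-composable paths zero), $\epsilon_i$ the idempotent of vertex $i$, and $P_i^{(n)}=B_n\epsilon_i$, which has as basis the paths of $Q_n$ starting at $i$. Put $B_n^{\mathrm{ev}}=\bigoplus_{i\text{ even},\,0\leq i\leq n}P_i^{(n)}$. Let $p_m$ be the number of paths from $0$ to $m$ in $Q_\infty$ (including the length-$0$ path, so $p_0=1$). Let $d_0=1$, $d_1=0$, $d_2=1$ and $d_n=d_{n-2}+d_{n-3}$ for $n\geq3$. (In the paper, $B_n$ arises as the Nori algebra of mixed Tate motives over $\mathbb{Z}$ with weights in $[0,n]$, shown to be this path algebra.) -}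

module Defs where

open import Data.Nat using (ℕ; zero; suc; _+_; _∸_; _≤_; _<_)
open import Data.Nat.Divisibility using (_∣_)
open import Data.Fin using (Fin)
open import Data.Product using (Σ; _×_)
open import Data.Unit using (⊤)
open import Data.Empty using (⊥)
open import Function.Bundles using (_↔_)

e : ℕ → ℕ
e 0 = 0
e 1 = 0
e 2 = 0
e 3 = 1
e (suc (suc (suc (suc s)))) = e (suc (suc s))

d : ℕ → ℕ
d 0 = 1
d 1 = 0
d 2 = 1
d (suc (suc (suc n))) = d (suc n) + d n

-- Paths in the quiver whose vertex set is {v : ℕ | V v} and which has
-- exactly e (k - j) edges (indexed by Fin (e (k ∸ j))) from j to k for j < k.
data Path (V : ℕ → Set) : ℕ → ℕ → Set where
  here : ∀ {i} → V i → Path V i i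
  step : ∀ {i j k} → V k → j < k → Fin (e (k ∸ j)) → Path V i j → Path V i k

VQ : ℕ → ℕ → Set
VQ n v = v ≤ n

VQ∞ : ℕ → Set
VQ∞ _ = ⊤

-- basis of P_i^{(n)} = B_n ε_i : the paths of Q_n starting at i
BasisP : ℕ → ℕ → Set
BasisP n i = Σ ℕ (λ k → Path (VQ n) i k)

-- basis of B_n^ev = ⊕_{i even, 0 ≤ i ≤ n} P_i^{(n)}
BasisEv : ℕ → Set
BasisEv n = Σ ℕ (λ i → (2 ∣ i) × (i ≤ n) × BasisP n i)

BasisEvPrev : ℕ → Set
BasisEvPrev zero = ⊥
BasisEvPrev (suc n) = BasisEv n

-- a ℚ-vector space with basis indexed by A has dimension k
HasDim : Set → ℕ → Set
HasDim A k = A ↔ Fin k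

{-# OPTIONS --safe #-}
module Submission where

-- A path of Q∞ into 3 + m either ends with the edge m → 3 + m, or its last edge j → 3 + m (j < m)
-- can be redirected to j → 1 + m, because e (s + 2) = e s for s ≥ 2. So if the allowed sources W
-- satisfy W (3 + m) ≅ W (1 + m) (the even vertices, or the single vertex 0), the number N k of
-- paths into k with source in W satisfies N (k + 3) = N (k + 1) + N k, the recurrence of d, and N
-- is determined by N 0 = |W 0|, N 1 = |W 1|, N 2 = |W 2|. Even sources give N = d, the source 0
-- gives p_k = d_{k-3}. Finally, the paths of Q_n are exactly the paths of Q∞ ending at a vertex
-- ≤ n, so dim B_n^ev = d 0 + ⋯ + d n.

open import Defs
open import Data.Nat using (ℕ; zero; suc; _+_; _∸_; _≤_; _<_; z≤n; s≤s; NonZero)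
open import Data.Nat.Properties
  using (≤-refl; ≤-trans; <⇒≤; ≤-irrelevant; ≡-irrelevant; *-cancelʳ-≡; +-identityʳ; +-assoc; +-comm)
open import Data.Nat.Divisibility using (_∣_; divides; ∣m∣n⇒∣m+n; ∣m+n∣m⇒∣n; ∣-refl)
open import Data.Fin using (Fin; zero)
open import Data.Fin.Properties using (+↔⊎)
open import Data.Product using (Σ; _×_; _,_; ∃-syntax)
open import Data.Product.Algebra using (×-cong)
open import Data.Product.Function.Dependent.Propositional using (congˡ)
open import Data.Sum using (_⊎_; inj₁; inj₂; [_,_])
open import Data.Sum.Algebra using (⊎-cong; ⊎-assoc)
open import Data.Unit using (tt)
open import Data.Empty using (⊥-elim)
open import Function using (_∘_; id)
open import Function.Bundles using (_↔_; mk↔ₛ′)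
open import Function.Properties.Inverse using (↔-refl; ↔-sym; ↔-trans)
open import Function.Related.Propositional using (bijection; module EquationalReasoning)
open import Function.Related.TypeIsomorphisms using (Σ-distribˡ-⊎; ×-distribʳ-⊎; ∃-≡)
open import Relation.Nullary using (¬_; Irrelevant)
open import Relation.Binary.PropositionalEquality using (_≡_; refl; cong; cong₂; sym; trans; subst)

private
  variable
    A B : Set
    W : ℕ → Set
    i j k m n : ℕ

empty↔empty : ¬ A → ¬ B → A ↔ B
empty↔empty ¬a ¬b = mk↔ₛ′ (⊥-elim ∘ ¬a) (⊥-elim ∘ ¬b) (⊥-elim ∘ ¬b) (⊥-elim ∘ ¬a)

⊎-identityʳ-¬ : ¬ B → (A ⊎ B) ↔ A
⊎-identityʳ-¬ ¬b = mk↔ₛ′ [ id , ⊥-elim ∘ ¬b ] inj₁ (λ _ → refl) [ (λ _ → refl) , ⊥-elim ∘ ¬b ]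

HasDim-⊥ : ¬ A → HasDim A 0
HasDim-⊥ ¬a = empty↔empty ¬a (λ ())

HasDim-⊤ : A → Irrelevant A → HasDim A 1
HasDim-⊤ a irr = mk↔ₛ′ (λ _ → zero) (λ _ → a) (λ { zero → refl }) (irr a)

HasDim-⊎ : HasDim A m → HasDim B n → HasDim (A ⊎ B) (m + n)
HasDim-⊎ A↔ B↔ = ↔-trans (⊎-cong A↔ B↔) (↔-sym +↔⊎)

Padovan : (ℕ → ℕ) → Set
Padovan f = ∀ m → f (3 + m) ≡ f (1 + m) + f m

module _ {T : ℕ → Set} {f : ℕ → ℕ} (rec : Padovan f)
         (split : ∀ m → T (3 + m) ↔ (T (1 + m) ⊎ T m))
         (dim₀ : HasDim (T 0) (f 0)) (dim₁ : HasDim (T 1) (f 1)) (dim₂ : HasDim (T 2) (f 2)) where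

  HasDim-padovan : ∀ m → HasDim (T m) (f m)
  HasDim-padovan 0 = dim₀
  HasDim-padovan 1 = dim₁
  HasDim-padovan 2 = dim₂
  HasDim-padovan (suc (suc (suc m))) = subst (HasDim (T (3 + m))) (sym (rec m))
    (↔-trans (split m) (HasDim-⊎ (HasDim-padovan (suc m)) (HasDim-padovan m)))

sum< : (ℕ → ℕ) → ℕ → ℕ
sum< f zero = 0
sum< f (suc n) = f 0 + sum< (f ∘ suc) n

sum<-suc : ∀ f n → sum< f (suc n) ≡ sum< f n + f n
sum<-suc f zero = +-identityʳ (f 0)
sum<-suc f (suc n) = trans (cong (f 0 +_) (sum<-suc (f ∘ suc) n)) (sym (+-assoc (f 0) _ _))

Σ<-suc : {F : ℕ → Set} → (Σ ℕ λ k → k < suc n × F k) ↔ (F 0 ⊎ Σ ℕ λ k → k < n × F (suc k))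
Σ<-suc {n} {F} = mk↔ₛ′ to from [ (λ _ → refl) , (λ _ → refl) ] from∘to
  where
  to : (Σ ℕ λ k → k < suc n × F k) → F 0 ⊎ Σ ℕ λ k → k < n × F (suc k)
  to (zero , _ , x) = inj₁ x
  to (suc k , s≤s k<n , x) = inj₂ (k , k<n , x)
  from : F 0 ⊎ (Σ ℕ λ k → k < n × F (suc k)) → Σ ℕ λ k → k < suc n × F k
  from (inj₁ x) = 0 , s≤s z≤n , x
  from (inj₂ (k , k<n , x)) = suc k , s≤s k<n , x
  from∘to : ∀ x → from (to x) ≡ x
  from∘to (zero , s≤s z≤n , x) = refl
  from∘to (suc k , s≤s k<n , x) = refl

HasDim-Σ< : {F : ℕ → Set} {f : ℕ → ℕ} → (∀ k → HasDim (F k) (f k)) →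
  ∀ n → HasDim (Σ ℕ λ k → k < n × F k) (sum< f n)
HasDim-Σ< dim zero = HasDim-⊥ λ { (_ , () , _) }
HasDim-Σ< dim (suc n) = ↔-trans Σ<-suc (HasDim-⊎ (dim 0) (HasDim-Σ< (dim ∘ suc) n))

Edge : ℕ → ℕ → Set
Edge j k = j < k × Fin (e (k ∸ j))

Edge-suc : Edge (suc j) (suc k) ↔ Edge j k
Edge-suc = mk↔ₛ′ (λ { (s≤s j<k , x) → j<k , x }) (λ { (j<k , x) → s≤s j<k , x })
                 (λ _ → refl) (λ { (s≤s _ , _) → refl })

e⇒3≤ : ∀ s → Fin (e s) → 3 ≤ s
e⇒3≤ (suc (suc (suc s))) _ = s≤s (s≤s (s≤s z≤n))

Edge⇒3+≤ : Edge j k → 3 + j ≤ k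
Edge⇒3+≤ {zero} {k} (_ , x) = e⇒3≤ k x
Edge⇒3+≤ {suc j} {suc k} (s≤s j<k , x) = s≤s (Edge⇒3+≤ (j<k , x))

suc-≡↔ : (suc j ≡ suc k) ↔ (j ≡ k)
suc-≡↔ = mk↔ₛ′ (λ { refl → refl }) (cong suc) (λ { refl → refl }) (λ { refl → refl })

-- e (s + 2) = e s for s ≥ 2, whereas e 3 = 1 and e 1 = 0.
Edge-shift : ∀ j m → Edge j (3 + m) ↔ (Edge j (1 + m) ⊎ j ≡ m)
Edge-shift zero zero = mk↔ₛ′ (λ _ → inj₂ refl) (λ _ → s≤s z≤n , zero)
  (λ { (inj₁ (_ , ())) ; (inj₂ refl) → refl }) (λ { (s≤s z≤n , zero) → refl })
Edge-shift zero (suc m) =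
  mk↔ₛ′ (λ { (s≤s z≤n , x) → inj₁ (s≤s z≤n , x) })
        [ (λ { (s≤s z≤n , x) → s≤s z≤n , x }) , (λ ()) ]
        [ (λ { (s≤s z≤n , _) → refl }) , (λ ()) ] (λ { (s≤s z≤n , _) → refl })
Edge-shift (suc j) zero =
  empty↔empty (λ edge → ⊥-elim (contra (Edge⇒3+≤ edge))) [ (λ { (s≤s () , _) }) , (λ ()) ]
  where
  contra : ¬ (4 + j ≤ 3)
  contra (s≤s (s≤s (s≤s ())))
Edge-shift (suc j) (suc m) =
  ↔-trans Edge-suc (↔-trans (Edge-shift j m) (⊎-cong (↔-sym Edge-suc) (↔-sym suc-≡↔)))

Paths : (ℕ → Set) → ℕ → Set
Paths W k = Σ ℕ λ i → W i × Path VQ∞ i k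

Paths-unfold : Paths W k ↔ (W k ⊎ Σ ℕ λ j → Edge j k × Paths W j)
Paths-unfold {W} {k} = mk↔ₛ′ to from [ (λ _ → refl) , (λ _ → refl) ] from∘to
  where
  to : Paths W k → W k ⊎ Σ ℕ λ j → Edge j k × Paths W j
  to (_ , w , here _) = inj₁ w
  to (i , w , step _ j<k x q) = inj₂ (_ , (j<k , x) , i , w , q)
  from : W k ⊎ (Σ ℕ λ j → Edge j k × Paths W j) → Paths W k
  from (inj₁ w) = k , w , here tt
  from (inj₂ (_ , (j<k , x) , i , w , q)) = i , w , step tt j<k x q
  from∘to : ∀ q → from (to q) ≡ q
  from∘to (_ , _ , here _) = refl
  from∘to (_ , _ , step _ _ _ _) = refl

Paths-base : k ≤ 2 → Paths W k ↔ W k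
Paths-base k≤2 =
  ↔-trans Paths-unfold (⊎-identityʳ-¬ λ (_ , edge , _) → contra (≤-trans (Edge⇒3+≤ edge) k≤2))
  where
  contra : ¬ (3 + j ≤ 2)
  contra (s≤s (s≤s ()))

Paths-shift : W (3 + m) ↔ W (1 + m) → Paths W (3 + m) ↔ (Paths W (1 + m) ⊎ Paths W m)
Paths-shift {W} {m} W-shift = begin
  Paths W (3 + m)
    ↔⟨ Paths-unfold ⟩
  (W (3 + m) ⊎ Σ ℕ λ j → Edge j (3 + m) × Paths W j)
    ↔⟨ ⊎-cong W-shift (congˡ {k = bijection} (×-cong (Edge-shift _ m) ↔-refl)) ⟩
  (W (1 + m) ⊎ Σ ℕ λ j → (Edge j (1 + m) ⊎ j ≡ m) × Paths W j)
    ↔⟨ ⊎-cong ↔-refl (↔-trans (congˡ {k = bijection} ×-distribʳ-⊎) Σ-distribˡ-⊎) ⟩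
  (W (1 + m) ⊎ (Σ ℕ λ j → Edge j (1 + m) × Paths W j) ⊎ (Σ ℕ λ j → j ≡ m × Paths W j))
    ↔⟨ ⊎-assoc _ _ _ _ ⟨
  ((W (1 + m) ⊎ Σ ℕ λ j → Edge j (1 + m) × Paths W j) ⊎ (Σ ℕ λ j → j ≡ m × Paths W j))
    ↔⟨ ⊎-cong (↔-sym Paths-unfold) (↔-sym (∃-≡ (Paths W))) ⟩
  (Paths W (1 + m) ⊎ Paths W m) ∎
  where open EquationalReasoning

HasDim-Paths : {f : ℕ → ℕ} → Padovan f → (∀ m → W (3 + m) ↔ W (1 + m)) →
  HasDim (W 0) (f 0) → HasDim (W 1) (f 1) → HasDim (W 2) (f 2) →
  ∀ k → HasDim (Paths W k) (f k)
HasDim-Paths rec W-shift dim₀ dim₁ dim₂ = HasDim-padovan rec (λ m → Paths-shift (W-shift m))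
  (↔-trans (Paths-base z≤n) dim₀)
  (↔-trans (Paths-base (s≤s z≤n)) dim₁)
  (↔-trans (Paths-base (s≤s (s≤s z≤n))) dim₂)

∣-irrelevant : ∀ {m n} .{{_ : NonZero m}} → Irrelevant (m ∣ n)
∣-irrelevant {m} (divides q eq) (divides q′ eq′) with *-cancelʳ-≡ q q′ m (trans (sym eq) eq′)
... | refl = cong (divides q) (≡-irrelevant eq eq′)

∣-+-self : ∀ {m n} .{{_ : NonZero m}} → m ∣ m + n ↔ m ∣ n
∣-+-self = mk↔ₛ′ (λ m∣m+n → ∣m+n∣m⇒∣n m∣m+n ∣-refl) (∣m∣n⇒∣m+n ∣-refl)
                 (λ _ → ∣-irrelevant _ _) (λ _ → ∣-irrelevant _ _)

HasDim-Paths-even : ∀ k → HasDim (Paths (2 ∣_) k) (d k)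
HasDim-Paths-even = HasDim-Paths (λ _ → refl) (λ _ → ∣-+-self)
  (HasDim-⊤ (divides 0 refl) ∣-irrelevant)
  (HasDim-⊥ λ { (divides (suc _) ()) })
  (HasDim-⊤ (divides 1 refl) ∣-irrelevant)

-- d continued three steps backwards by its own recurrence, then shifted: p m = d (m - 3).
p : ℕ → ℕ
p 0 = 1
p 1 = 0
p 2 = 0
p (suc (suc (suc n))) = d n

p-padovan : Padovan p
p-padovan 0 = refl
p-padovan 1 = refl
p-padovan 2 = refl
p-padovan (suc (suc (suc m))) = refl

HasDim-Path-from-0 : ∀ m → HasDim (Path VQ∞ 0 m) (p m)
HasDim-Path-from-0 m = ↔-trans (∃-≡ (λ i → Path VQ∞ i m))
  (HasDim-Paths {f = p} p-padovan (λ _ → empty↔empty (λ ()) (λ ()))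
    (HasDim-⊤ refl ≡-irrelevant) (HasDim-⊥ λ ()) (HasDim-⊥ λ ()) m)

source≤target : ∀ {V} → Path V i k → i ≤ k
source≤target (here _) = ≤-refl
source≤target (step _ j<k _ q) = ≤-trans (source≤target q) (<⇒≤ j<k)

module _ {n : ℕ} where

  forget : Path (VQ n) i k → Path VQ∞ i k
  forget (here _) = here tt
  forget (step _ j<k x q) = step tt j<k x (forget q)

  restrict : k ≤ n → Path VQ∞ i k → Path (VQ n) i k
  restrict k≤n (here _) = here k≤n
  restrict k≤n (step _ j<k x q) = step k≤n j<k x (restrict (≤-trans (<⇒≤ j<k) k≤n) q)

  target≤ : Path (VQ n) i k → k ≤ n
  target≤ (here k≤n) = k≤n
  target≤ (step k≤n _ _ _) = k≤n

  forget-restrict : (k≤n : k ≤ n) (q : Path VQ∞ i k) → forget (restrict k≤n q) ≡ q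
  forget-restrict _ (here _) = refl
  forget-restrict _ (step _ j<k x q) = cong (step tt j<k x) (forget-restrict _ q)

  restrict-forget : (k≤n : k ≤ n) (q : Path (VQ n) i k) → restrict k≤n (forget q) ≡ q
  restrict-forget k≤n (here k≤n′) = cong here (≤-irrelevant k≤n k≤n′)
  restrict-forget k≤n (step k≤n′ j<k x q) =
    cong₂ (λ k≤n q → step k≤n j<k x q) (≤-irrelevant k≤n k≤n′) (restrict-forget _ q)

BasisEv↔ : BasisEv n ↔ (Σ ℕ λ k → k < suc n × Paths (2 ∣_) k)
BasisEv↔ {n} = mk↔ₛ′ to from to∘from from∘to
  where
  to : BasisEv n → Σ ℕ λ k → k < suc n × Paths (2 ∣_) k
  to (i , i-even , _ , k , q) = k , s≤s (target≤ q) , i , i-even , forget q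
  from : (Σ ℕ λ k → k < suc n × Paths (2 ∣_) k) → BasisEv n
  from (k , s≤s k≤n , i , i-even , q) =
    i , i-even , ≤-trans (source≤target q) k≤n , k , restrict k≤n q
  to∘from : ∀ x → to (from x) ≡ x
  to∘from (k , s≤s k≤n , i , i-even , q) =
    cong₂ (λ k≤n q → k , s≤s k≤n , i , i-even , q) (≤-irrelevant _ _) (forget-restrict k≤n q)
  from∘to : ∀ x → from (to x) ≡ x
  from∘to (i , i-even , _ , k , q) =
    cong₂ (λ i≤n q → i , i-even , i≤n , k , q) (≤-irrelevant _ _) (restrict-forget _ q)

HasDim-BasisEv : ∀ n → HasDim (BasisEv n) (sum< d (suc n))
HasDim-BasisEv n = ↔-trans BasisEv↔ (HasDim-Σ< HasDim-Paths-even (suc n))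

HasDim-BasisEvPrev : ∀ n → HasDim (BasisEvPrev n) (sum< d n)
HasDim-BasisEvPrev zero = HasDim-⊥ λ ()
HasDim-BasisEvPrev (suc n) = HasDim-BasisEv n

proposition7p16 : (n : ℕ) →
    ∃[ a ] ∃[ b ] ∃[ p ]
      ( HasDim (BasisEv n) a
      × HasDim (BasisEvPrev n) b
      × HasDim (Path VQ∞ 0 (n + 3)) p
      × a ≡ b + d n
      × d n ≡ p )
proposition7p16 n =
  sum< d (suc n) , sum< d n , d n ,
  HasDim-BasisEv n ,
  HasDim-BasisEvPrev n ,
  subst (λ m → HasDim (Path VQ∞ 0 m) (d n)) (+-comm 3 n) (HasDim-Path-from-0 (3 + n)) ,
  sum<-suc d n ,
  refl
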